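{- Let $q$ be a prime power, $r \geq 2$ an integer, and $S := \left\langle q^{r-1}, \frac{q^r-1}{q-1}\right\rangle$ with conductor $c(S)$. Let $\lambda_1,\lambda_2,\lambda_1',\lambda_2' \in \mathbb{N}$ with $\frac{\lambda_1}{q} \leq \lambda_2 \leq \frac{\lambda_1}{q-1}$ and $\frac{\lambda_1'}{q} \leq \lambda_2' \leq \frac{\lambda_1'}{q-1}$. If $\lambda_1 \frac{q^{r-1}-1}{q-1} + \lambda_2 \leq c(S)$ and $\lambda_1' \frac{q^{r-1}-1}{q-1} + \lambda_2' \leq c(S)$, then $$\lambda_1 \frac{q^{r-1}-1}{q-1} + \lambda_2 \leq \lambda_1' \frac{q^{r-1}-1}{q-1} + \lambda_2' \iff (\lambda_1,\lambda_2) \preceq_{\mathrm{lex}} (\lambda_1',\lambda_2').$$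
   Context: $\mathbb{N} = \{0,1,2,\ldots\}$. For a numerical semigroup $S$, $c(S) := \max(\mathbb{N}\setminus S) + 1$. $\preceq_{\mathrm{lex}}$ is the lexicographic order on $\mathbb{Z}^2$: $(a,b) \preceq_{\mathrm{lex}} (a',b')$ iff $(a,b)=(a',b')$ or the leftmost nonzero entry of $(a'-a, b'-b)$ is positive. -}

module Defs where

open import Data.Nat using (ℕ; zero; suc; _+_; _*_; _∸_; _^_; _≤_; _<_)
open import Data.Nat.DivMod using (_/_)
open import Data.Nat.Primality using (Prime)
open import Data.Product using (Σ; ∃; _×_; _,_)
open import Data.Sum using (_⊎_)
open import Relation.Binary.PropositionalEquality using (_≡_)
open import Relation.Nullary using (¬_)

IsPrimePower : ℕ → Set
IsPrimePower q = Σ ℕ λ p → Σ ℕ λ k → Prime p × 1 ≤ k × q ≡ p ^ k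

-- exact division by (q - 1); for q ≤ 1 returns 0 (never used: q prime power ⇒ q ≥ 2)
divPred : ℕ → ℕ → ℕ
divPred zero          x = 0
divPred (suc zero)    x = 0
divPred (suc (suc k)) x = x / suc k

qnum : ℕ → ℕ → ℕ
qnum q m = divPred q (q ^ m ∸ 1)

In⟨_,_⟩ : ℕ → ℕ → ℕ → Set
In⟨ g₁ , g₂ ⟩ n = Σ ℕ λ a → Σ ℕ λ b → n ≡ a * g₁ + b * g₂

-- c is the conductor c(S) = max(ℕ \ S) + 1 of a numerical semigroup S
-- (with c = 0 when S = ℕ): every n ≥ c lies in S, and if c > 0 then c - 1 ∉ S.
IsConductor : (ℕ → Set) → ℕ → Set
IsConductor S c = (∀ n → c ≤ n → S n) × (∀ m → c ≡ suc m → ¬ S m)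

_⪯lex_ : ℕ × ℕ → ℕ × ℕ → Set
(a , b) ⪯lex (a' , b') = (a ≡ a' × b ≡ b') ⊎ (a < a') ⊎ (a ≡ a' × b < b')

-- Write m = (q^(r-1) - 1)/(q - 1), so that the generators are a = q^(r-1) = 1 + (q-1) m and
-- b = 1 + q m, related by q a = (q-1) b + 1.  This relation shows that every n ≥ (b-1) a lies
-- in S, hence c ≤ (b-1) a, which forces λ₁ ≤ (q-1) q m for an admissible pair of weight
-- λ₁ m + λ₂ ≤ c.  Scaled by q (q-1), the weight of an admissible pair lies between
-- (q-1) b λ₁ and (q-1) b λ₁ + λ₁ with λ₁ < (q-1) b, so the weight increases strictly with λ₁,
-- and for equal λ₁ it increases with λ₂.
module Submission where

open import Defs
open import Data.Nat
open import Data.Nat.Properties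
open import Data.Nat.DivMod using (_%_; _/_; m%n<n; m≡m%n+[m/n]*n; m*n/n≡m)
open import Data.Nat.Primality using (prime⇒nonTrivial; prime⇒nonZero)
open import Data.Nat.Tactic.RingSolver using (solve-∀)
open import Data.Product using (_,_)
open import Data.Sum using (inj₁; inj₂)
open import Function.Bundles using (_⇔_; mk⇔)
open import Relation.Binary.Definitions using (tri<; tri≈; tri>)
open import Relation.Binary.PropositionalEquality
open import Relation.Nullary using (contradiction)

geom : ℕ → ℕ → ℕ
geom q zero    = 0
geom q (suc n) = 1 + q * geom q n

suc^≡1+*geom : ∀ Q n → suc Q ^ n ≡ 1 + Q * geom (suc Q) n
suc^≡1+*geom Q zero    = sym (cong suc (*-zeroʳ Q))
suc^≡1+*geom Q (suc n) = trans (cong (suc Q *_) (suc^≡1+*geom Q n)) (step Q (geom (suc Q) n))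
  where
  step : ∀ Q g → suc Q * (1 + Q * g) ≡ 1 + Q * (1 + suc Q * g)
  step = solve-∀

qnum≡geom : ∀ k n → qnum (2 + k) n ≡ geom (2 + k) n
qnum≡geom k n rewrite suc^≡1+*geom (suc k) n | *-comm (suc k) (geom (2 + k) n) =
  m*n/n≡m (geom (2 + k) n) (suc k)

x+y≡n+z⇒x+[y∸z]≡n : ∀ {x y z n} → x + y ≡ n + z → x ≤ n → x + (y ∸ z) ≡ n
x+y≡n+z⇒x+[y∸z]≡n {x} {y} {z} {n} x+y≡n+z x≤n = begin
  x + (y ∸ z)      ≡⟨ cong (λ w → x + (w ∸ z)) y≡d+z ⟩
  x + (d + z ∸ z)  ≡⟨ cong (x +_) (m+n∸n≡m d z) ⟩
  x + d            ≡⟨ m+[n∸m]≡n x≤n ⟩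
  n                ∎
  where
  open ≡-Reasoning
  d = n ∸ x
  y≡d+z : y ≡ d + z
  y≡d+z = +-cancelˡ-≡ x y (d + z) (begin
    x + y        ≡⟨ x+y≡n+z ⟩
    n + z        ≡⟨ cong (_+ z) (m+[n∸m]≡n x≤n) ⟨
    x + d + z    ≡⟨ +-assoc x d z ⟩
    x + (d + z)  ∎)

-- Since q a ≡ 1 (mod b), t := n q mod b satisfies t a ≡ n (mod b), and t ≤ b′ gives t a ≤ n.
∈⟨⟩-beyond : ∀ a b′ q Q → q * a ≡ Q * suc b′ + 1 → ∀ n → b′ * a ≤ n → In⟨ a , suc b′ ⟩ n
∈⟨⟩-beyond a b′ q Q bezout n b′a≤n = t , u * a ∸ n * Q , sym n≡ta+sb
  where
  open ≡-Reasoning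
  b = suc b′
  t = n * q % b
  u = n * q / b
  ta≤n : t * a ≤ n
  ta≤n = ≤-trans (*-monoˡ-≤ a (s≤s⁻¹ (m%n<n (n * q) b))) b′a≤n
  distrib : ∀ t u a b → (t + u * b) * a ≡ t * a + u * a * b
  distrib = solve-∀
  distrib′ : ∀ n Q b → n * (Q * b + 1) ≡ n + n * Q * b
  distrib′ = solve-∀
  nqa : t * a + u * a * b ≡ n + n * Q * b
  nqa = begin
    t * a + u * a * b  ≡⟨ distrib t u a b ⟨
    (t + u * b) * a    ≡⟨ cong (_* a) (m≡m%n+[m/n]*n (n * q) b) ⟨
    n * q * a          ≡⟨ *-assoc n q a ⟩
    n * (q * a)        ≡⟨ cong (n *_) bezout ⟩
    n * (Q * b + 1)    ≡⟨ distrib′ n Q b ⟩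
    n + n * Q * b      ∎
  n≡ta+sb : t * a + (u * a ∸ n * Q) * b ≡ n
  n≡ta+sb = begin
    t * a + (u * a ∸ n * Q) * b      ≡⟨ cong (t * a +_) (*-distribʳ-∸ b (u * a) (n * Q)) ⟩
    t * a + (u * a * b ∸ n * Q * b)  ≡⟨ x+y≡n+z⇒x+[y∸z]≡n nqa ta≤n ⟩
    n                                ∎

isConductor⇒≤ : ∀ {S : ℕ → Set} {c N} → IsConductor S c → (∀ n → N ≤ n → S n) → c ≤ N
isConductor⇒≤ {c = zero}   _         _    = z≤n
isConductor⇒≤ {c = suc c′} (_ , gap) full = ≮⇒≥ (λ N<c → gap c′ refl (full c′ (s≤s⁻¹ N<c)))

module Weight (Q m : ℕ) where

  q a b : ℕ
  q = suc Q
  a = suc (Q * m)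
  b = suc (q * m)

  weight : ℕ → ℕ → ℕ
  weight l₁ l₂ = l₁ * m + l₂

  q*a≡Q*b+1 : q * a ≡ Q * b + 1
  q*a≡Q*b+1 = identity Q m
    where
    identity : ∀ Q m → suc Q * suc (Q * m) ≡ Q * suc (suc Q * m) + 1
    identity = solve-∀

  l₁*b≤q*weight : ∀ {l₁ l₂} → l₁ ≤ q * l₂ → l₁ * b ≤ q * weight l₁ l₂
  l₁*b≤q*weight {l₁} {l₂} l₁≤ql₂ = begin
    l₁ * b                  ≡⟨ identity Q m l₁ ⟩
    q * (l₁ * m) + l₁       ≤⟨ +-monoʳ-≤ (q * (l₁ * m)) l₁≤ql₂ ⟩
    q * (l₁ * m) + q * l₂   ≡⟨ *-distribˡ-+ q (l₁ * m) l₂ ⟨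
    q * weight l₁ l₂        ∎
    where
    open ≤-Reasoning
    identity : ∀ Q m l₁ → l₁ * suc (suc Q * m) ≡ suc Q * (l₁ * m) + l₁
    identity = solve-∀

  weight≤⇒l₁≤Q*q*m : ∀ {l₁ l₂} → l₁ ≤ q * l₂ → weight l₁ l₂ ≤ q * m * a → l₁ ≤ Q * (q * m)
  weight≤⇒l₁≤Q*q*m {l₁} {l₂} l₁≤ql₂ w≤ = s≤s⁻¹ (*-cancelʳ-< b l₁ (suc (Q * (q * m))) (begin-strict
    l₁ * b                       ≤⟨ l₁*b≤q*weight l₁≤ql₂ ⟩
    q * weight l₁ l₂             ≤⟨ *-monoʳ-≤ q w≤ ⟩
    q * (q * m * a)              ≡⟨ identity Q m ⟩
    Q * (q * m) * b + q * m      <⟨ +-monoʳ-< (Q * (q * m) * b) (n<1+n (q * m)) ⟩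
    Q * (q * m) * b + b          ≡⟨ +-comm (Q * (q * m) * b) b ⟩
    suc (Q * (q * m)) * b        ∎))
    where
    open ≤-Reasoning
    identity : ∀ Q m → suc Q * (suc Q * m * suc (Q * m))
                       ≡ Q * (suc Q * m) * suc (suc Q * m) + suc Q * m
    identity = solve-∀

  weight-< : ∀ {l₁ l₂ l₁′ l₂′} → l₁ < l₁′ → Q * l₂ ≤ l₁ → l₁′ ≤ q * l₂′ →
             weight l₁′ l₂′ ≤ q * m * a → weight l₁ l₂ < weight l₁′ l₂′
  weight-< {l₁} {l₂} {l₁′} {l₂′} l₁<l₁′ Ql₂≤l₁ l₁′≤ql₂′ w′≤ =
    *-cancelˡ-< (Q * q) (weight l₁ l₂) (weight l₁′ l₂′) (begin-strict
      Q * q * weight l₁ l₂              ≡⟨ expand Q m l₁ l₂ ⟩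
      Q * q * (l₁ * m) + q * (Q * l₂)   ≤⟨ +-monoʳ-≤ (Q * q * (l₁ * m)) (*-monoʳ-≤ q Ql₂≤l₁) ⟩
      Q * q * (l₁ * m) + q * l₁         ≡⟨ regroup Q m l₁ ⟩
      Q * (l₁ * b) + l₁                 <⟨ +-monoʳ-< (Q * (l₁ * b)) l₁<Qb ⟩
      Q * (l₁ * b) + Q * b              ≡⟨ *-distribˡ-+ Q (l₁ * b) b ⟨
      Q * (l₁ * b + b)                  ≡⟨ cong (Q *_) (+-comm (l₁ * b) b) ⟩
      Q * (suc l₁ * b)                  ≤⟨ *-monoʳ-≤ Q (*-monoˡ-≤ b l₁<l₁′) ⟩
      Q * (l₁′ * b)                     ≤⟨ *-monoʳ-≤ Q (l₁*b≤q*weight l₁′≤ql₂′) ⟩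
      Q * (q * weight l₁′ l₂′)          ≡⟨ *-assoc Q q (weight l₁′ l₂′) ⟨
      Q * q * weight l₁′ l₂′            ∎)
    where
    open ≤-Reasoning
    expand : ∀ Q m l₁ l₂ → Q * suc Q * (l₁ * m + l₂) ≡ Q * suc Q * (l₁ * m) + suc Q * (Q * l₂)
    expand = solve-∀
    regroup : ∀ Q m l₁ → Q * suc Q * (l₁ * m) + suc Q * l₁ ≡ Q * (l₁ * suc (suc Q * m)) + l₁
    regroup = solve-∀
    l₁<Qb : l₁ < Q * b
    l₁<Qb = <-≤-trans l₁<l₁′ (≤-trans (weight≤⇒l₁≤Q*q*m l₁′≤ql₂′ w′≤) (*-monoʳ-≤ Q (n≤1+n (q * m))))

  weight≤⇔⪯lex : ∀ {l₁ l₂ l₁′ l₂′} →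
    l₁ ≤ q * l₂ → Q * l₂ ≤ l₁ → l₁′ ≤ q * l₂′ → Q * l₂′ ≤ l₁′ →
    weight l₁ l₂ ≤ q * m * a → weight l₁′ l₂′ ≤ q * m * a →
    weight l₁ l₂ ≤ weight l₁′ l₂′ ⇔ (l₁ , l₂) ⪯lex (l₁′ , l₂′)
  weight≤⇔⪯lex {l₁} {l₂} {l₁′} {l₂′} l₁≤ql₂ Ql₂≤l₁ l₁′≤ql₂′ Ql₂′≤l₁′ w≤ w′≤ = mk⇔ to from
    where
    to : weight l₁ l₂ ≤ weight l₁′ l₂′ → (l₁ , l₂) ⪯lex (l₁′ , l₂′)
    to w≤w′ with <-cmp l₁ l₁′
    ... | tri< l₁<l₁′ _ _ = inj₂ (inj₁ l₁<l₁′)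
    ... | tri> _ _ l₁′<l₁ = contradiction w≤w′ (<⇒≱ (weight-< l₁′<l₁ Ql₂′≤l₁′ l₁≤ql₂ w≤))
    ... | tri≈ _ refl _ with <-cmp l₂ l₂′
    ...   | tri< l₂<l₂′ _ _ = inj₂ (inj₂ (refl , l₂<l₂′))
    ...   | tri≈ _ l₂≡l₂′ _ = inj₁ (refl , l₂≡l₂′)
    ...   | tri> _ _ l₂′<l₂ = contradiction w≤w′ (<⇒≱ (+-monoʳ-< (l₁ * m) l₂′<l₂))
    from : (l₁ , l₂) ⪯lex (l₁′ , l₂′) → weight l₁ l₂ ≤ weight l₁′ l₂′
    from (inj₁ (refl , refl))         = ≤-refl
    from (inj₂ (inj₁ l₁<l₁′))         = <⇒≤ (weight-< l₁<l₁′ Ql₂≤l₁ l₁′≤ql₂′ w′≤)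
    from (inj₂ (inj₂ (refl , l₂<l₂′))) = +-monoʳ-≤ (l₁ * m) (<⇒≤ l₂<l₂′)

isPrimePower⇒2≤ : ∀ {q} → IsPrimePower q → 2 ≤ q
isPrimePower⇒2≤ (p , k , p-prime , 1≤k , refl) = begin
  2       ≤⟨ nonTrivial⇒n>1 p ⟩
  p       ≡⟨ ^-identityʳ p ⟨
  p ^ 1   ≤⟨ ^-monoʳ-≤ p 1≤k ⟩
  p ^ k   ∎
  where
  open ≤-Reasoning
  instance
    _ = prime⇒nonTrivial p-prime
    _ = prime⇒nonZero p-prime

lemma5p2 : (q r c l₁ l₂ l₁' l₂' : ℕ) → IsPrimePower q → 2 ≤ r →
    IsConductor In⟨ q ^ (r ∸ 1) , qnum q r ⟩ c →
    l₁ ≤ q * l₂ → (q ∸ 1) * l₂ ≤ l₁ →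
    l₁' ≤ q * l₂' → (q ∸ 1) * l₂' ≤ l₁' →
    l₁ * qnum q (r ∸ 1) + l₂ ≤ c →
    l₁' * qnum q (r ∸ 1) + l₂' ≤ c →
    (l₁ * qnum q (r ∸ 1) + l₂ ≤ l₁' * qnum q (r ∸ 1) + l₂') ⇔ ((l₁ , l₂) ⪯lex (l₁' , l₂'))
lemma5p2 _ zero _ _ _ _ _ _ ()
lemma5p2 _ (suc r) c l₁ l₂ l₁′ l₂′ q-pp _ cond l₁≤ql₂ Ql₂≤l₁ l₁′≤ql₂′ Ql₂′≤l₁′ w≤c w′≤c
  with isPrimePower⇒2≤ q-pp
... | s≤s (s≤s {n = k} z≤n)
  rewrite qnum≡geom k (suc r) | qnum≡geom k r | suc^≡1+*geom (suc k) r =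
  weight≤⇔⪯lex l₁≤ql₂ Ql₂≤l₁ l₁′≤ql₂′ Ql₂′≤l₁′ (≤-trans w≤c c≤) (≤-trans w′≤c c≤)
  where
  m : ℕ
  m = geom (2 + k) r
  open Weight (suc k) m
  c≤ : c ≤ q * m * a
  c≤ = isConductor⇒≤ cond (∈⟨⟩-beyond a (q * m) q (suc k) q*a≡Q*b+1)
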